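{- If an infinite binary word $w$ is not weak abelian periodic, then $w$ has frequencies of letters, i.e. for each letter $a\in\{0,1\}$ the limit $\lim_{n\to\infty}|w_1\cdots w_n|_a/n$ exists.
   Context: For a finite word $u$, $|u|_a$ is the number of occurrences of the letter $a$ in $u$ and, for $u$ nonempty, $\rho_a(u)=|u|_a/|u|$. An infinite word $w$ over a finite alphabet $\Sigma$ is weak abelian periodic if $w=v_0v_1v_2\cdots$ with finite words $v_i$ ($v_i$ nonempty for $i\ge1$) such that $\rho_a(v_i)=\rho_a(v_j)$ for all $a\in\Sigma$ and all $i,j\ge1$. -}

module Defs where

open import Data.Bool using (Bool; true; false)
open import Data.Nat using (ℕ; zero; suc; _+_; _≤_)
open import Data.Integer using (+_)
open import Data.Rational using (ℚ; _/_; _-_; ∣_∣; _<_; Positive)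
open import Data.Product using (Σ; ∃; _×_)
open import Relation.Binary.PropositionalEquality using (_≡_)

-- An infinite binary word: w i is the (i+1)-th letter (0-based positions).
Word : Set
Word = ℕ → Bool

δ : Bool → Bool → ℕ
δ true  true  = 1
δ false false = 1
δ true  false = 0
δ false true  = 0

count : Bool → Word → ℕ → ℕ → ℕ
count a w s zero    = 0
count a w s (suc n) = δ a (w s) + count a w (suc s) n

-- ρ_a of the (nonempty) factor of length (suc n) starting at s
ρ : Bool → Word → ℕ → ℕ → ℚ
ρ a w s n = (+ count a w s (suc n)) / suc n

-- Decomposition w = v₀ v₁ v₂ ⋯ : |v₀| = p₀ (possibly 0), and for i ≥ 0 the block
-- v_{i+1} has length suc (ℓ i) (nonempty). start p₀ ℓ i = position where v_{i+1} begins.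
start : ℕ → (ℕ → ℕ) → ℕ → ℕ
start p₀ ℓ zero    = p₀
start p₀ ℓ (suc i) = start p₀ ℓ i + suc (ℓ i)

WeakAbelianPeriodic : Word → Set
WeakAbelianPeriodic w =
  Σ ℕ λ p₀ → Σ (ℕ → ℕ) λ ℓ →
    ∀ (a : Bool) (i j : ℕ) →
      ρ a w (start p₀ ℓ i) (ℓ i) ≡ ρ a w (start p₀ ℓ j) (ℓ j)

-- Prefix frequency: ρ_a(w_1 ⋯ w_{n+1}).
prefixFreq : Bool → Word → ℕ → ℚ
prefixFreq a w n = ρ a w 0 n

-- Cauchy sequence of rationals (= convergent in ℝ).
Cauchy : (ℕ → ℚ) → Set
Cauchy f = ∀ (ε : ℚ) → Positive ε →
  ∃ λ N → ∀ m n → N ≤ m → N ≤ n → ∣ f m - f n ∣ < ε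

HasFrequencies : Word → Set
HasFrequencies w = ∀ (a : Bool) → Cauchy (prefixFreq a w)

module Submission where

-- Fix a letter a, write C L = |w₀ ⋯ w_{L-1}|_a and a resolution M = d + 1.
-- Since C grows by at most one per letter, the path L ↦ M·C L moves up by at most M per
-- step.  If it lies infinitely often strictly below and infinitely often on or above the
-- line L ↦ k·L, it therefore hits infinitely often one of the finitely many parallel lines
-- M·C L = k·L + c (c < M), hence one fixed such line infinitely often.  The blocks between
-- consecutive hits all have a-frequency k/M (and so the same frequency of the other letter):
-- w is weak abelian periodic.  For a word that is not, a discrete intermediate-value
-- argument over the slopes k = 0, …, M + 1 yields a j with j·L ≤ M·C L < (j+1)·L for all
-- large L.  So the prefix frequencies eventually lie in a window of width 1/M; as M is
-- arbitrary they form a Cauchy sequence.  Classical logic decides the "infinitely often"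
-- statements (the paper's argument is classical).

open import Defs
open import Level using (0ℓ)
open import Axiom.ExcludedMiddle using (ExcludedMiddle)
open import Relation.Nullary using (¬_; yes; no; contradiction)
open import Data.Bool using (Bool; true; false; not)
open import Data.Nat using (ℕ; zero; suc; _+_; _*_; _∸_; _≤_; _<_; z≤n; s≤s; _≤?_; NonZero)
import Data.Nat.Properties as NP
open import Data.Nat.Tactic.RingSolver using (solve-∀)
open import Data.Nat.Coprimality using (Coprime)
open import Data.Integer as ℤ using (+_; +[1+_])
import Data.Integer.Properties as ZP
open import Data.Rational as ℚ using (mkℚ; _/_; toℚᵘ)
import Data.Rational.Properties as QP
open import Data.Rational.Unnormalised as U using (mkℚᵘ)
import Data.Rational.Unnormalised.Properties as UP
open import Algebra.Properties.CommutativeSemigroup NP.+-commutativeSemigroup using (interchange)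
open import Algebra.Properties.CommutativeSemigroup NP.*-commutativeSemigroup using (xy∙z≈xz∙y)
open import Algebra.Properties.AbelianGroup QP.+-0-abelianGroup using (⁻¹-anti-homo‿-)
open import Data.Product using (Σ; ∃; _×_; _,_; proj₁; proj₂)
open import Data.Sum using (inj₁; inj₂)
open import Relation.Binary.PropositionalEquality

δ≤1 : ∀ a b → δ a b ≤ 1
δ≤1 true  true  = s≤s z≤n
δ≤1 false false = s≤s z≤n
δ≤1 true  false = z≤n
δ≤1 false true  = z≤n

count≤length : ∀ a w s n → count a w s n ≤ n
count≤length a w s zero    = z≤n
count≤length a w s (suc n) = NP.+-mono-≤ (δ≤1 a (w s)) (count≤length a w (suc s) n)

δ-complement : ∀ a b → δ a b + δ (not a) b ≡ 1
δ-complement true  true  = refl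
δ-complement true  false = refl
δ-complement false true  = refl
δ-complement false false = refl

count-complement : ∀ a w s n → count a w s n + count (not a) w s n ≡ n
count-complement a w s zero    = refl
count-complement a w s (suc n) = begin
  (δ a (w s) + count a w (suc s) n) + (δ (not a) (w s) + count (not a) w (suc s) n)
    ≡⟨ interchange (δ a (w s)) (count a w (suc s) n) (δ (not a) (w s)) (count (not a) w (suc s) n) ⟩
  (δ a (w s) + δ (not a) (w s)) + (count a w (suc s) n + count (not a) w (suc s) n)
    ≡⟨ cong₂ _+_ (δ-complement a (w s)) (count-complement a w (suc s) n) ⟩
  suc n ∎
  where open ≡-Reasoning

count-+ : ∀ a w s p n → count a w s (p + n) ≡ count a w s p + count a w (s + p) n
count-+ a w s zero    n rewrite NP.+-identityʳ s = refl
count-+ a w s (suc p) n rewrite count-+ a w (suc s) p n | NP.+-suc s p =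
  sym (NP.+-assoc (δ a (w s)) (count a w (suc s) p) (count a w (suc s + p) n))

count-suc≤ : ∀ a w s L → count a w s (suc L) ≤ suc (count a w s L)
count-suc≤ a w s L = begin
  count a w s (suc L)                     ≡⟨ cong (count a w s) (NP.+-comm 1 L) ⟩
  count a w s (L + 1)                     ≡⟨ count-+ a w s L 1 ⟩
  count a w s L + count a w (s + L) 1     ≤⟨ NP.+-monoʳ-≤ (count a w s L) (count≤length a w (s + L) 1) ⟩
  count a w s L + 1                       ≡⟨ NP.+-comm (count a w s L) 1 ⟩
  suc (count a w s L)                     ∎
  where open NP.≤-Reasoning

fraction-≡ : ∀ x m y n → x * suc n ≡ y * suc m → + x / suc m ≡ + y / suc n
fraction-≡ x m y n eq = QP.fromℚᵘ-cong {mkℚᵘ (+ x) m} {mkℚᵘ (+ y) n} (U.*≡* cross)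
  where
  cross : + x ℤ.* + suc n ≡ + y ℤ.* + suc m
  cross = trans (sym (ZP.pos-* x (suc n))) (trans (cong +_ eq) (ZP.pos-* y (suc m)))

fraction-<-+ : ∀ x m y n k d .(cop : Coprime (suc k) (suc d)) →
               x * (suc d * suc n) < (suc k * suc n + y * suc d) * suc m →
               + x / suc m ℚ.< mkℚ (+ suc k) d cop ℚ.+ + y / suc n
fraction-<-+ x m y n k d cop lt = QP.toℚᵘ-cancel-<
  (UP.<-respˡ-≃ (UP.≃-sym (QP.toℚᵘ-fromℚᵘ (mkℚᵘ (+ x) m))) (UP.<-respʳ-≃ sum-≃ unnormalised))
  where
  unnormalised : mkℚᵘ (+ x) m U.< mkℚᵘ (+ suc k) d U.+ mkℚᵘ (+ y) n
  unnormalised = U.*<* (subst₂ ℤ._<_ lhs rhs (ℤ.+<+ lt))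
    where
    lhs : + (x * (suc d * suc n)) ≡ + x ℤ.* + (suc d * suc n)
    lhs = ZP.pos-* x (suc d * suc n)
    rhs : + ((suc k * suc n + y * suc d) * suc m) ≡ (+ suc k ℤ.* + suc n ℤ.+ + y ℤ.* + suc d) ℤ.* + suc m
    rhs = begin
      + ((suc k * suc n + y * suc d) * suc m)            ≡⟨ ZP.pos-* (suc k * suc n + y * suc d) (suc m) ⟩
      + (suc k * suc n + y * suc d) ℤ.* + suc m          ≡⟨ cong (ℤ._* + suc m) (ZP.pos-+ (suc k * suc n) (y * suc d)) ⟩
      (+ (suc k * suc n) ℤ.+ + (y * suc d)) ℤ.* + suc m  ≡⟨ cong₂ (λ p q → (p ℤ.+ q) ℤ.* + suc m) (ZP.pos-* (suc k) (suc n)) (ZP.pos-* y (suc d)) ⟩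
      (+ suc k ℤ.* + suc n ℤ.+ + y ℤ.* + suc d) ℤ.* + suc m ∎
      where open ≡-Reasoning
  sum-≃ : mkℚᵘ (+ suc k) d U.+ mkℚᵘ (+ y) n U.≃ toℚᵘ (mkℚ (+ suc k) d cop ℚ.+ + y / suc n)
  sum-≃ = UP.≃-trans (UP.+-congʳ (mkℚᵘ (+ suc k) d) (UP.≃-sym (QP.toℚᵘ-fromℚᵘ (mkℚᵘ (+ y) n))))
            (UP.≃-sym (QP.toℚᵘ-homo-+ (mkℚ (+ suc k) d cop) (+ y / suc n)))

-<-from-<-+ : ∀ p q e → p ℚ.< e ℚ.+ q → p ℚ.- q ℚ.< e
-<-from-<-+ p q e lt = subst (p ℚ.- q ℚ.<_) cancel (QP.+-monoˡ-< (ℚ.- q) lt)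
  where
  cancel : e ℚ.+ q ℚ.- q ≡ e
  cancel = trans (QP.+-assoc e q (ℚ.- q)) (trans (cong (e ℚ.+_) (QP.+-inverseʳ q)) (QP.+-identityʳ e))

∣-∣< : ∀ p q e → p ℚ.- q ℚ.< e → q ℚ.- p ℚ.< e → ℚ.∣ p ℚ.- q ∣ ℚ.< e
∣-∣< p q e p-q<e q-p<e with QP.∣p∣≡p∨∣p∣≡-p (p ℚ.- q)
... | inj₁ eq = subst (ℚ._< e) (sym eq) p-q<e
... | inj₂ eq = subst (ℚ._< e) (sym (trans eq (⁻¹-anti-homo‿- p q))) q-p<e

-- If x/m < (j+1)/M and y/n ≥ j/M, then x/m < (k+1)/M + y/n (cross-multiplied form).
window-gap : ∀ M x m y n j k .{{_ : NonZero n}} → M * x < suc j * m → j * n ≤ M * y →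
             x * (M * n) < (suc k * n + y * M) * m
window-gap M x m y n j k x-below y-above = begin-strict
  x * (M * n)                             ≡⟨ regroup x M n ⟩
  (M * x) * n                             <⟨ NP.*-monoˡ-< n x-below ⟩
  (suc j * m) * n                         ≡⟨ expand j m n ⟩
  m * n + (j * n) * m                     ≤⟨ NP.+-monoʳ-≤ (m * n) (NP.*-monoˡ-≤ m y-above) ⟩
  m * n + (M * y) * m                     ≤⟨ NP.m≤m+n (m * n + (M * y) * m) ((k * n) * m) ⟩
  m * n + (M * y) * m + (k * n) * m       ≡⟨ collect M y m n k ⟩
  (suc k * n + y * M) * m                 ∎
  where
  open NP.≤-Reasoning
  regroup : ∀ x M n → x * (M * n) ≡ (M * x) * n
  regroup = solve-∀
  expand : ∀ j m n → (suc j * m) * n ≡ m * n + (j * n) * m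
  expand = solve-∀
  collect : ∀ M y m n k → m * n + (M * y) * m + (k * n) * m ≡ (suc k * n + y * M) * m
  collect = solve-∀

Eventually : (ℕ → Set) → Set
Eventually P = ∃ λ N → ∀ L → N ≤ L → P L

InfinitelyOften : (ℕ → Set) → Set
InfinitelyOften P = ∀ N → ∃ λ L → N ≤ L × P L

eventually-× : {P Q : ℕ → Set} → Eventually P → Eventually Q → Eventually (λ L → P L × Q L)
eventually-× (N₁ , p) (N₂ , q) =
  N₁ + N₂ , λ L le → p L (NP.≤-trans (NP.m≤m+n N₁ N₂) le) , q L (NP.≤-trans (NP.m≤n+m N₂ N₁) le)

eventually-map : {P Q : ℕ → Set} → (∀ {L} → P L → Q L) → Eventually P → Eventually Q
eventually-map f (N , p) = N , λ L le → f (p L le)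

eventually-∀< : {P : ℕ → ℕ → Set} → ∀ m → (∀ c → c < m → Eventually (P c)) →
                Eventually (λ L → ∀ c → c < m → P c L)
eventually-∀< zero    ev = 0 , λ L _ c ()
eventually-∀< {P} (suc m) ev with eventually-× (eventually-∀< m (λ c c<m → ev c (NP.m<n⇒m<1+n c<m))) (ev m (NP.n<1+n m))
... | N , both = N , all
  where
  all : ∀ L → N ≤ L → ∀ c → c < suc m → P c L
  all L le c c<1+m with NP.m<1+n⇒m<n∨m≡n c<1+m
  ... | inj₁ c<m  = proj₁ (both L le) c c<m
  ... | inj₂ refl = proj₂ (both L le)

increasing-enumeration : {P : ℕ → Set} → InfinitelyOften P →
                         Σ (ℕ → ℕ) λ t → (∀ i → t i < t (suc i)) × (∀ i → P (t i))
increasing-enumeration {P} io = t , increasing , holds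
  where
  t : ℕ → ℕ
  t zero    = proj₁ (io 0)
  t (suc i) = proj₁ (io (suc (t i)))
  increasing : ∀ i → t i < t (suc i)
  increasing i = proj₁ (proj₂ (io (suc (t i))))
  holds : ∀ i → P (t i)
  holds zero    = proj₂ (proj₂ (io 0))
  holds (suc i) = proj₂ (proj₂ (io (suc (t i))))

module Classical (lem : ExcludedMiddle 0ℓ) where

  ¬io⇒eventually-¬ : {P : ℕ → Set} → ¬ InfinitelyOften P → Eventually (λ L → ¬ P L)
  ¬io⇒eventually-¬ {P} ¬io with lem {Eventually (λ L → ¬ P L)}
  ... | yes ev  = ev
  ... | no ¬ev = contradiction io ¬io
    where
    io : InfinitelyOften P
    io N with lem {∃ λ L → N ≤ L × P L}
    ... | yes found = found
    ... | no none   = contradiction (N , λ L le p → none (L , le , p)) ¬ev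

  io-pigeonhole : {P : ℕ → ℕ → Set} → ∀ m → InfinitelyOften (λ L → ∃ λ c → c < m × P c L) →
                  ∃ λ c → InfinitelyOften (P c)
  io-pigeonhole {P} m io with lem {∃ λ c → InfinitelyOften (P c)}
  ... | yes found = found
  ... | no none   =
    let N , never        = eventually-∀< m (λ c _ → ¬io⇒eventually-¬ (λ io-c → none (c , io-c)))
        L , N≤L , c , c<m , p = io N
    in contradiction p (never L N≤L c c<m)

  discrete-ivt : (Q : ℕ → Set) → ¬ Q 0 → ∀ n → Q n → ∃ λ i → ¬ Q i × Q (suc i)
  discrete-ivt Q ¬Q0 zero    Q0 = contradiction Q0 ¬Q0
  discrete-ivt Q ¬Q0 (suc n) Qn+1 with lem {Q n}
  ... | yes Qn = discrete-ivt Q ¬Q0 n Qn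
  ... | no ¬Qn = n , ¬Qn , Qn+1

equal-ratio : ∀ M k x₁ l₁ x₂ l₂ .{{_ : NonZero M}} → M * x₁ ≡ k * l₁ → M * x₂ ≡ k * l₂ →
              x₁ * l₂ ≡ x₂ * l₁
equal-ratio M k x₁ l₁ x₂ l₂ eq₁ eq₂ = NP.*-cancelˡ-≡ (x₁ * l₂) (x₂ * l₁) M (begin
  M * (x₁ * l₂)   ≡⟨ NP.*-assoc M x₁ l₂ ⟨
  (M * x₁) * l₂   ≡⟨ cong (_* l₂) eq₁ ⟩
  (k * l₁) * l₂   ≡⟨ xy∙z≈xz∙y k l₁ l₂ ⟩
  (k * l₂) * l₁   ≡⟨ cong (_* l₁) eq₂ ⟨
  (M * x₂) * l₁   ≡⟨ NP.*-assoc M x₂ l₁ ⟩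
  M * (x₂ * l₁)   ∎)
  where open ≡-Reasoning

equal-ratio-complement : ∀ x₁ y₁ l₁ x₂ y₂ l₂ → x₁ + y₁ ≡ l₁ → x₂ + y₂ ≡ l₂ →
                         x₁ * l₂ ≡ x₂ * l₁ → y₁ * l₂ ≡ y₂ * l₁
equal-ratio-complement x₁ y₁ l₁ x₂ y₂ l₂ sum₁ sum₂ eq = NP.+-cancelˡ-≡ (x₁ * l₂) (y₁ * l₂) (y₂ * l₁) (begin
  x₁ * l₂ + y₁ * l₂   ≡⟨ NP.*-distribʳ-+ l₂ x₁ y₁ ⟨
  (x₁ + y₁) * l₂      ≡⟨ cong (_* l₂) sum₁ ⟩
  l₁ * l₂             ≡⟨ NP.*-comm l₁ l₂ ⟩
  l₂ * l₁             ≡⟨ cong (_* l₁) sum₂ ⟨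
  (x₂ + y₂) * l₁      ≡⟨ NP.*-distribʳ-+ l₁ x₂ y₂ ⟩
  x₂ * l₁ + y₂ * l₁   ≡⟨ cong (_+ y₂ * l₁) eq ⟨
  x₁ * l₂ + y₂ * l₁   ∎)
  where open ≡-Reasoning

-- Cut points t 0 < t 1 < ⋯ split w as v₀ v₁ v₂ ⋯ with v_{i+1} = w[t i, t (suc i)).
module Cuts (w : Word) (t : ℕ → ℕ) (increasing : ∀ i → t i < t (suc i)) where

  -- |v_{i+1}| = suc (gap i).
  gap : ℕ → ℕ
  gap i = t (suc i) ∸ suc (t i)

  block-end : ∀ i → t i + suc (gap i) ≡ t (suc i)
  block-end i = trans (NP.+-suc (t i) (gap i)) (NP.m+[n∸m]≡n (increasing i))

  start-at-cuts : ∀ i → start (t 0) gap i ≡ t i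
  start-at-cuts zero    = refl
  start-at-cuts (suc i) = trans (cong (_+ suc (gap i)) (start-at-cuts i)) (block-end i)

  blockCount : Bool → ℕ → ℕ
  blockCount b i = count b w (t i) (suc (gap i))

  Proportional : Bool → Set
  Proportional b = ∀ i j → blockCount b i * suc (gap j) ≡ blockCount b j * suc (gap i)

  proportional-other : ∀ a → Proportional a → Proportional (not a)
  proportional-other a prop i j = equal-ratio-complement
    (blockCount a i) (blockCount (not a) i) (suc (gap i)) (blockCount a j) (blockCount (not a) j) (suc (gap j))
    (count-complement a w (t i) (suc (gap i))) (count-complement a w (t j) (suc (gap j))) (prop i j)

  proportional-all : ∀ a → Proportional a → ∀ b → Proportional b
  proportional-all true  prop true  = prop
  proportional-all false prop false = prop
  proportional-all true  prop false = proportional-other true prop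
  proportional-all false prop true  = proportional-other false prop

  wap-from-proportional : ∀ a → Proportional a → WeakAbelianPeriodic w
  wap-from-proportional a prop = t 0 , gap , same-ρ
    where
    same-ρ : ∀ b i j → ρ b w (start (t 0) gap i) (gap i) ≡ ρ b w (start (t 0) gap j) (gap j)
    same-ρ b i j rewrite start-at-cuts i | start-at-cuts j =
      fraction-≡ (blockCount b i) (gap i) (blockCount b j) (gap j) (proportional-all a prop b i j)

module Crossing (w : Word) (a : Bool) (d : ℕ) where

  M : ℕ
  M = suc d

  C : ℕ → ℕ
  C L = count a w 0 L

  Below Above : ℕ → ℕ → Set
  Below k L = M * C L < k * L
  Above k L = k * L ≤ M * C L

  OnLine : ℕ → ℕ → ℕ → Set
  OnLine k c L = M * C L ≡ k * L + c

  -- Going from below to (weakly) above in one step lands on a line k·L + c with c < M,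
  -- because one step raises M·C by at most M.
  step-onto-line : ∀ k L → Below k L → Above k (suc L) → ∃ λ c → c < M × OnLine k c (suc L)
  step-onto-line k L below above = c , c<M , sym (trans (NP.+-comm (k * suc L) c) (NP.m∸n+n≡m above))
    where
    c = M * C (suc L) ∸ k * suc L
    c<M : c < M
    c<M = NP.+-cancelʳ-< (k * suc L) c M (begin-strict
      c + k * suc L     ≡⟨ NP.m∸n+n≡m above ⟩
      M * C (suc L)     ≤⟨ NP.*-monoʳ-≤ M (count-suc≤ a w 0 L) ⟩
      M * suc (C L)     ≡⟨ NP.*-suc M (C L) ⟩
      M + M * C L       <⟨ NP.+-monoʳ-< M below ⟩
      M + k * L         ≤⟨ NP.+-monoʳ-≤ M (NP.*-monoʳ-≤ k (NP.n≤1+n L)) ⟩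
      M + k * suc L     ∎)
      where open NP.≤-Reasoning

  crossing : ∀ k e L → Below k L → Above k (L + e) → ∃ λ L′ → L < L′ × ∃ λ c → c < M × OnLine k c L′
  crossing k zero L below above rewrite NP.+-identityʳ L = contradiction above (NP.<⇒≱ below)
  crossing k (suc e) L below above with k * (L + e) ≤? M * C (L + e)
  ... | yes above′ = crossing k e L below above′
  ... | no ¬above′ = suc (L + e) , s≤s (NP.m≤m+n L e) ,
                     step-onto-line k (L + e) (NP.≰⇒> ¬above′) (subst (Above k) (NP.+-suc L e) above)

  io-crossing : ∀ k → InfinitelyOften (Below k) → InfinitelyOften (Above k) →
                InfinitelyOften (λ L → ∃ λ c → c < M × OnLine k c L)
  io-crossing k io-below io-above N with io-below N
  ... | L , N≤L , below with io-above (suc L)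
  ... | L′ , L<L′ , above with crossing k (L′ ∸ L) L below (subst (Above k) (sym (NP.m+[n∸m]≡n (NP.<⇒≤ L<L′))) above)
  ... | L″ , L<L″ , hit = L″ , NP.≤-trans N≤L (NP.<⇒≤ L<L″) , hit

  block-on-line : ∀ k c s n → OnLine k c s → OnLine k c (s + n) → M * count a w s n ≡ k * n
  block-on-line k c s n on-s on-s+n = NP.+-cancelˡ-≡ (k * s + c) (M * count a w s n) (k * n) (begin
    k * s + c + M * count a w s n       ≡⟨ cong (_+ M * count a w s n) on-s ⟨
    M * C s + M * count a w s n         ≡⟨ NP.*-distribˡ-+ M (C s) (count a w s n) ⟨
    M * (C s + count a w s n)           ≡⟨ cong (M *_) (count-+ a w 0 s n) ⟨
    M * C (s + n)                       ≡⟨ on-s+n ⟩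
    k * (s + n) + c                     ≡⟨ regroup k s n c ⟩
    k * s + c + k * n                   ∎)
    where
    open ≡-Reasoning
    regroup : ∀ k s n c → k * (s + n) + c ≡ k * s + c + k * n
    regroup = solve-∀

  -- If a line is hit infinitely often, its hits are cut points with proportional blocks.
  io-line⇒wap : ∀ k c → InfinitelyOften (OnLine k c) → WeakAbelianPeriodic w
  io-line⇒wap k c io with increasing-enumeration io
  ... | t , increasing , on = wap-from-proportional a proportional
    where
    open Cuts w t increasing
    ratio : ∀ i → M * blockCount a i ≡ k * suc (gap i)
    ratio i = block-on-line k c (t i) (suc (gap i)) (on i) (subst (OnLine k c) (sym (block-end i)) (on (suc i)))
    proportional : Proportional a
    proportional i j = equal-ratio M k (blockCount a i) (suc (gap i)) (blockCount a j) (suc (gap j)) (ratio i) (ratio j)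

InWindow : Bool → Word → ℕ → ℕ → ℕ → Set
InWindow a w d j L = j * L ≤ suc d * count a w 0 L × suc d * count a w 0 L < suc j * L

window-close : ∀ a w d j k .(cop : Coprime (suc k) (suc d)) → Eventually (InWindow a w d j) →
               ∃ λ N → ∀ m n → N ≤ m → N ≤ n →
                 ℚ.∣ prefixFreq a w m ℚ.- prefixFreq a w n ∣ ℚ.< mkℚ (+ suc k) d cop
window-close a w d j k cop (N , in-window) =
  N , λ m n N≤m N≤n → ∣-∣< (prefixFreq a w m) (prefixFreq a w n) ε (difference< m n N≤m N≤n) (difference< n m N≤n N≤m)
  where
  ε = mkℚ (+ suc k) d cop
  C : ℕ → ℕ
  C L = count a w 0 L
  difference< : ∀ m n → N ≤ m → N ≤ n → prefixFreq a w m ℚ.- prefixFreq a w n ℚ.< ε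
  difference< m n N≤m N≤n = -<-from-<-+ (prefixFreq a w m) (prefixFreq a w n) ε
    (fraction-<-+ (C (suc m)) m (C (suc n)) n k d cop
      (window-gap (suc d) (C (suc m)) (suc m) (C (suc n)) (suc n) j k
        (proj₂ (in-window (suc m) (NP.m≤n⇒m≤1+n N≤m)))
        (proj₁ (in-window (suc n) (NP.m≤n⇒m≤1+n N≤n)))))

windows⇒cauchy : ∀ a w → (∀ d → ∃ λ j → Eventually (InWindow a w d j)) → Cauchy (prefixFreq a w)
windows⇒cauchy a w windows (mkℚ +[1+ k ] d cop) _ =
  window-close a w d (proj₁ (windows d)) k cop (proj₂ (windows d))

-- For a word that is not weak abelian periodic, some window catches the prefix frequencies:
-- choose the last slope j the path is not infinitely often below; the path cannot be
-- infinitely often above slope j + 1 either, or it would hit a line infinitely often.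
module Windows (lem : ExcludedMiddle 0ℓ) (w : Word) (¬wap : ¬ WeakAbelianPeriodic w) (a : Bool) (d : ℕ) where
  open Classical lem
  open Crossing w a d

  never-below-0 : ¬ InfinitelyOften (Below 0)
  never-below-0 io = NP.n≮0 (proj₂ (proj₂ (io 0)))

  -- Since C L ≤ L, the path is always strictly below the line of slope M + 1.
  always-below-M+1 : InfinitelyOften (Below (suc M))
  always-below-M+1 N = suc N , NP.n≤1+n N ,
    NP.≤-<-trans (NP.*-monoʳ-≤ M (count≤length a w 0 (suc N))) (NP.m<n+m (M * suc N) (s≤s z≤n))

  window-at : ∀ j → ¬ InfinitelyOften (Below j) → InfinitelyOften (Below (suc j)) →
              Eventually (InWindow a w d j)
  window-at j ¬io-below-j io-below-j+1 = eventually-× eventually-above eventually-below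
    where
    eventually-above : Eventually (Above j)
    eventually-above = eventually-map NP.≮⇒≥ (¬io⇒eventually-¬ ¬io-below-j)
    ¬io-above : ¬ InfinitelyOften (Above (suc j))
    ¬io-above io-above =
      let c , io-line = io-pigeonhole M (io-crossing (suc j) io-below-j+1 io-above)
      in ¬wap (io-line⇒wap (suc j) c io-line)
    eventually-below : Eventually (Below (suc j))
    eventually-below = eventually-map NP.≰⇒> (¬io⇒eventually-¬ ¬io-above)

  window-exists : ∃ λ j → Eventually (InWindow a w d j)
  window-exists =
    let j , ¬io-below-j , io-below-j+1 = discrete-ivt (λ k → InfinitelyOften (Below k)) never-below-0 (suc M) always-below-M+1
    in j , window-at j ¬io-below-j io-below-j+1

corollary1 : ExcludedMiddle 0ℓ → (w : Word) → ¬ WeakAbelianPeriodic w → HasFrequencies w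
corollary1 lem w ¬wap a = windows⇒cauchy a w (λ d → Windows.window-exists lem w ¬wap a d)
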